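{- If $G\in\mathcal{F}_2$, then $G$ is a singleton-partition graph and ${\rm CG}(G,\Gamma_1)\in\mathcal{H}_2$.
   Context: All graphs are finite and simple. A full vertex is a vertex adjacent to all other vertices. A set $D\subseteq V$ is dominating if every vertex not in $D$ has a neighbor in $D$. Two disjoint sets $A,B\subseteq V$ form a coalition if neither is dominating but $A\cup B$ is. A coalition partition of $G$ is a partition $\mathcal{P}$ of $V$ such that every member is either a dominating set of cardinality 1, or is not dominating and forms a coalition with some other member of $\mathcal{P}$. The coalition graph ${\rm CG}(G,\mathcal{P})$ has vertex set $\mathcal{P}$, two members adjacent iff they form a coalition. $\Gamma_1$ is the partition of $V$ into singletons; $G$ is a singleton-partition graph if $\Gamma_1$ is a coalition partition of $G$. The family $\mathcal{F}_2=\mathcal{F}_2^1\cup\mathcal{F}_2^2\cup\mathcal{F}_2^3$. In each case $G$ has vertex set $V=\{x,y,z\}\cup L_1\cup R_1\cup R_2\cup L_2\cup W$, where $L_1,R_1,R_2,L_2$ are pairwise disjoint (and disjoint from $\{x,y,z\}$), the set $W$ may intersect $L_1\cup R_1\cup R_2\cup L_2$, and $N(x)=\{y,z\}$. (1) $\mathcal{F}_2^1$: $W=L_1=L_2=R_2=\emptyset$, $R_1\ne\emptyset$; $y$ and $z$ are both adjacent to every vertex of $R_1$, $yz$ is not an edge; arbitrary edges (possibly none) among vertices of $R_1$. The graph has $\delta=2$ and no full vertex. (2) $\mathcal{F}_2^2$: $W=L_2=R_2=\emptyset$, $L_1\ne\emptyset$, $R_1\ne\emptyset$; $y$ is adjacent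 to every vertex of $L_1\cup R_1$, $yz$ is not an edge; $z$ is adjacent to every vertex of $R_1$ and to no vertex of $L_1$; $G[L_1]$ is complete; arbitrary edges (possibly none) among vertices of $R_1$; finally any additional edges may be added while maintaining minimum degree $2$ and not creating a full vertex. The graph has $\delta=2$ and no full vertex. (3) $\mathcal{F}_2^3$: $L_1,R_2,W$ are nonempty and $L_2\subseteq W$ (possibly $L_2=\emptyset$); $G[W]$ is complete and every vertex of $W$ is adjacent to all vertices of $L_1\cup R_1\cup R_2$; $y$ is adjacent to every vertex of $L_1\cup R_1$ and to no vertex of $R_2$; $z$ is adjacent to every vertex of $R_1\cup R_2$ and to no vertex of $L_1$; each vertex of $R_1$ is adjacent to all vertices of $L_1$ or to all vertices of $R_2$. Either $yz$ is not an edge, in which case $G[L_1]$ and $G[R_2]$ are complete; or $yz$ is an edge, in which case each vertex of $L_1$ is adjacent to all (other) vertices of $L_1$ or to all vertices of $R_2$, and likewise each vertex of $R_2$ is adjacent to all vertices of $L_1$ or to all (other) vertices of $R_2$. Finally any additional edges may be added while maintaining minimum degree $2$ and not creating a full vertex. The graph has $\delta=2$ and no full vertex. The family $\mathcal{H}_2=\mathcal{H}_2^1\cup\mathcal{H}_2^2\cup\mathcal{H}_2^3$: (1) $\mathcal{H}_2^1$: vertex set $\{x',y',z'\}\cup R_1'$ with $R_1'\neq\emptyset$; $\{x',y',z'\}$ induces $K_3$; every vertex of $R_1'$ is adjacent to both $y'$ and $z'$; $R_1'$ is independent; additionally $x'$ may be joined to some (possibly none) vertices of $R_1'$; no other edges.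 (2) $\mathcal{H}_2^2$: vertex set $\{x',y',z'\}\cup R_1'\cup L_1'$ with $R_1'\ne\emptyset$, $L_1'\ne\emptyset$; $y'$ is adjacent to every vertex of $R_1'$ and to $x'$ and $z'$; $z'$ is adjacent to every vertex of $L_1'$; $x'z'$ is not an edge; no vertex of $L_1'$ is adjacent to $y'$; $L_1'\cup R_1'$ is independent; additional edges may be added (possibly none), subject to every vertex of $L_1'$ either having degree 1 with unique neighbor $z'$ or having degree 2 with neighbors $x'$ and $z'$. (3) $\mathcal{H}_2^3$: vertex set $\{x',y',z'\}\cup L_1'\cup R_1'\cup R_2'\cup W'$ with $W'\ne\emptyset$, the sets $L_1',R_1',R_2',W'$ pairwise disjoint and $L_1',R_1',R_2'$ possibly empty; $L_1'\cup R_1'\cup R_2'\cup W'$ is independent; $x'y'$ and $x'z'$ are not edges; $x'$ is adjacent to all vertices of $W'$ and to no vertex of $\{y',z'\}\cup L_1'\cup R_1'\cup R_2'$; each vertex of $L_1'\cup R_1'\cup R_2'$ is adjacent to at least one of $y'$ and $z'$. -}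

module Defs where

open import Level using (0ℓ)
open import Data.Nat using (ℕ)
open import Data.Fin using (Fin)
open import Data.Product using (Σ; ∃; ∃₂; _×_; _,_)
open import Data.Sum using (_⊎_)
open import Data.Empty using (⊥)
open import Relation.Nullary using (¬_; Dec)
open import Relation.Unary using (Pred; _∈_; _∉_; _⊆_; Satisfiable; _∪_)
open import Relation.Binary.PropositionalEquality using (_≡_; _≢_)
open import Function.Bundles using (_⇔_)
open import Function.Base using (id)

record SimpleGraph (n : ℕ) : Set₁ where
  field
    Adj    : Fin n → Fin n → Set
    sym    : ∀ {u v} → Adj u v → Adj v u
    irrefl : ∀ {v} → ¬ Adj v v
    dec    : ∀ u v → Dec (Adj u v)
open SimpleGraph public

VSet : ℕ → Set₁
VSet n = Pred (Fin n) 0ℓ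

module _ {n : ℕ} (E : Fin n → Fin n → Set) where

  Dominating : VSet n → Set
  Dominating D = ∀ v → v ∉ D → ∃ λ u → u ∈ D × E v u

  Disjoint : VSet n → VSet n → Set
  Disjoint A B = ∀ v → v ∈ A → v ∈ B → ⊥

  Coalition : VSet n → VSet n → Set
  Coalition A B = Disjoint A B × ¬ Dominating A × ¬ Dominating B
                  × Dominating (A ∪ B)

  AdjAll : Fin n → VSet n → Set
  AdjAll v S = ∀ u → u ∈ S → u ≢ v → E v u

  AdjNone : Fin n → VSet n → Set
  AdjNone v S = ∀ u → u ∈ S → ¬ E v u

  Complete : VSet n → Set
  Complete S = ∀ u → u ∈ S → AdjAll u S

  Independent : VSet n → Set
  Independent S = ∀ u v → u ∈ S → v ∈ S → ¬ E u v

  MinDegreeTwo : Set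
  MinDegreeTwo =
    (∀ v → ∃₂ λ u w → u ≢ w × E v u × E v w)
    × (∃ λ v → ∃₂ λ u w → u ≢ w × (∀ t → E v t ⇔ (t ≡ u ⊎ t ≡ w)))

  NoFullVertex : Set
  NoFullVertex = ∀ v → ∃ λ u → u ≢ v × ¬ E v u

-- Partitions of Fin n: a surjective labelling of vertices by blocks Fin k;
-- the members of the partition are the fibres.

record Partition (n : ℕ) : Set where
  field
    k    : ℕ
    blk  : Fin n → Fin k
    surj : ∀ i → ∃ λ v → blk v ≡ i
open Partition public

member : ∀ {n} (P : Partition n) → Fin (k P) → VSet n
member P i v = blk P v ≡ i

HasCardinalityOne : ∀ {n} → VSet n → Set
HasCardinalityOne S = ∃ λ v → ∀ w → (w ∈ S ⇔ w ≡ v)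

IsCoalitionPartition : ∀ {n} → SimpleGraph n → Partition n → Set
IsCoalitionPartition G P = ∀ i →
  (Dominating (Adj G) (member P i) × HasCardinalityOne (member P i))
  ⊎ (¬ Dominating (Adj G) (member P i)
     × ∃ λ j → Coalition (Adj G) (member P i) (member P j))

CG : ∀ {n} → SimpleGraph n → (P : Partition n) → Fin (k P) → Fin (k P) → Set
CG G P i j = Coalition (Adj G) (member P i) (member P j)

Γ₁ : (n : ℕ) → Partition n
Γ₁ n = record { k = n ; blk = id ; surj = λ i → i , _≡_.refl }

SingletonPartitionGraph : ∀ {n} → SimpleGraph n → Set
SingletonPartitionGraph {n} G = IsCoalitionPartition G (Γ₁ n)

record F2Base {n : ℕ} (G : SimpleGraph n) : Set where
  field
    x y z  : Fin n
    x≢y    : x ≢ y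
    x≢z    : x ≢ z
    y≢z    : y ≢ z
    Nx     : ∀ v → Adj G x v ⇔ (v ≡ y ⊎ v ≡ z)
    δ≡2    : MinDegreeTwo (Adj G)
    noFull : NoFullVertex (Adj G)

NotXYZ : ∀ {n} → Fin n → Fin n → Fin n → VSet n → Set
NotXYZ x y z S = ∀ v → v ∈ S → v ≢ x × v ≢ y × v ≢ z

record F2-1 {n : ℕ} (G : SimpleGraph n) : Set₁ where
  field
    base : F2Base G
  open F2Base base
  field
    R₁      : VSet n
    R₁≠∅    : Satisfiable R₁
    R₁-disj : NotXYZ x y z R₁
    cover   : ∀ v → v ≡ x ⊎ v ≡ y ⊎ v ≡ z ⊎ v ∈ R₁
    yR₁     : ∀ r → r ∈ R₁ → Adj G y r
    zR₁     : ∀ r → r ∈ R₁ → Adj G z r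
    ¬yz     : ¬ Adj G y z

record F2-2 {n : ℕ} (G : SimpleGraph n) : Set₁ where
  field
    base : F2Base G
  open F2Base base
  field
    L₁ R₁     : VSet n
    L₁≠∅      : Satisfiable L₁
    R₁≠∅      : Satisfiable R₁
    L₁-disj   : NotXYZ x y z L₁
    R₁-disj   : NotXYZ x y z R₁
    L₁R₁-disj : Disjoint (Adj G) L₁ R₁
    cover     : ∀ v → v ≡ x ⊎ v ≡ y ⊎ v ≡ z ⊎ v ∈ L₁ ⊎ v ∈ R₁
    yL₁R₁     : AdjAll (Adj G) y (L₁ ∪ R₁)
    ¬yz       : ¬ Adj G y z
    zR₁       : AdjAll (Adj G) z R₁
    zL₁       : AdjNone (Adj G) z L₁
    L₁-compl  : Complete (Adj G) L₁

record F2-3 {n : ℕ} (G : SimpleGraph n) : Set₁ where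
  field
    base : F2Base G
  open F2Base base
  field
    L₁ R₁ R₂ L₂ W : VSet n
    L₁≠∅      : Satisfiable L₁
    R₂≠∅      : Satisfiable R₂
    W≠∅       : Satisfiable W
    L₂⊆W      : L₂ ⊆ W
    L₁-disj   : NotXYZ x y z L₁
    R₁-disj   : NotXYZ x y z R₁
    R₂-disj   : NotXYZ x y z R₂
    L₂-disj   : NotXYZ x y z L₂
    L₁R₁-disj : Disjoint (Adj G) L₁ R₁
    L₁R₂-disj : Disjoint (Adj G) L₁ R₂
    L₁L₂-disj : Disjoint (Adj G) L₁ L₂
    R₁R₂-disj : Disjoint (Adj G) R₁ R₂
    R₁L₂-disj : Disjoint (Adj G) R₁ L₂
    R₂L₂-disj : Disjoint (Adj G) R₂ L₂
    cover     : ∀ v → v ≡ x ⊎ v ≡ y ⊎ v ≡ z ⊎ v ∈ L₁ ⊎ v ∈ R₁ ⊎ v ∈ R₂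
                      ⊎ v ∈ L₂ ⊎ v ∈ W
    W-compl   : Complete (Adj G) W
    W-adj     : ∀ w → w ∈ W → AdjAll (Adj G) w (L₁ ∪ R₁ ∪ R₂)
    yL₁R₁     : AdjAll (Adj G) y (L₁ ∪ R₁)
    yR₂       : AdjNone (Adj G) y R₂
    zR₁R₂     : AdjAll (Adj G) z (R₁ ∪ R₂)
    zL₁       : AdjNone (Adj G) z L₁
    R₁-cond   : ∀ r → r ∈ R₁ → AdjAll (Adj G) r L₁ ⊎ AdjAll (Adj G) r R₂
    yz-cond   : (¬ Adj G y z × Complete (Adj G) L₁ × Complete (Adj G) R₂)
                ⊎ (Adj G y z
                   × (∀ l → l ∈ L₁ → AdjAll (Adj G) l L₁ ⊎ AdjAll (Adj G) l R₂)
                   × (∀ r → r ∈ R₂ → AdjAll (Adj G) r L₁ ⊎ AdjAll (Adj G) r R₂))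

InF2 : ∀ {n} → SimpleGraph n → Set₁
InF2 G = F2-1 G ⊎ F2-2 G ⊎ F2-3 G

-- The family H₂ (membership of a graph given by an adjacency relation on
-- Fin m; this is invariant under isomorphism, so it expresses "∈ H₂")

record H2-1 {m : ℕ} (E : Fin m → Fin m → Set) : Set₁ where
  field
    x y z    : Fin m
    x≢y      : x ≢ y
    x≢z      : x ≢ z
    y≢z      : y ≢ z
    R₁       : VSet m
    R₁≠∅     : Satisfiable R₁
    R₁-disj  : NotXYZ x y z R₁
    cover    : ∀ v → v ≡ x ⊎ v ≡ y ⊎ v ≡ z ⊎ v ∈ R₁
    xy       : E x y
    xz       : E x z
    yz       : E y z
    yR₁      : AdjAll E y R₁
    zR₁      : AdjAll E z R₁
    R₁-indep : Independent E R₁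
    -- edges between x and R₁ are arbitrary; there are no other pairs

record H2-2 {m : ℕ} (E : Fin m → Fin m → Set) : Set₁ where
  field
    x y z     : Fin m
    x≢y       : x ≢ y
    x≢z       : x ≢ z
    y≢z       : y ≢ z
    L₁ R₁     : VSet m
    L₁≠∅      : Satisfiable L₁
    R₁≠∅      : Satisfiable R₁
    L₁-disj   : NotXYZ x y z L₁
    R₁-disj   : NotXYZ x y z R₁
    L₁R₁-disj : Disjoint E L₁ R₁
    cover     : ∀ v → v ≡ x ⊎ v ≡ y ⊎ v ≡ z ⊎ v ∈ L₁ ⊎ v ∈ R₁
    yR₁       : AdjAll E y R₁
    yx        : E y x
    yz        : E y z
    zL₁       : AdjAll E z L₁
    ¬xz       : ¬ E x z
    yL₁       : AdjNone E y L₁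
    indep     : Independent E (L₁ ∪ R₁)
    L₁-deg    : ∀ l → l ∈ L₁ →
                  (∀ v → E l v ⇔ v ≡ z) ⊎ (∀ v → E l v ⇔ (v ≡ x ⊎ v ≡ z))

record H2-3 {m : ℕ} (E : Fin m → Fin m → Set) : Set₁ where
  field
    x y z      : Fin m
    x≢y        : x ≢ y
    x≢z        : x ≢ z
    y≢z        : y ≢ z
    L₁ R₁ R₂ W : VSet m
    W≠∅        : Satisfiable W
    L₁-disj    : NotXYZ x y z L₁
    R₁-disj    : NotXYZ x y z R₁
    R₂-disj    : NotXYZ x y z R₂
    W-disj     : NotXYZ x y z W
    L₁R₁-disj  : Disjoint E L₁ R₁
    L₁R₂-disj  : Disjoint E L₁ R₂
    L₁W-disj   : Disjoint E L₁ W
    R₁R₂-disj  : Disjoint E R₁ R₂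
    R₁W-disj   : Disjoint E R₁ W
    R₂W-disj   : Disjoint E R₂ W
    cover      : ∀ v → v ≡ x ⊎ v ≡ y ⊎ v ≡ z ⊎ v ∈ L₁ ⊎ v ∈ R₁ ⊎ v ∈ R₂ ⊎ v ∈ W
    indep      : Independent E (L₁ ∪ R₁ ∪ R₂ ∪ W)
    ¬xy        : ¬ E x y
    ¬xz        : ¬ E x z
    xW         : AdjAll E x W
    xNone      : AdjNone E x (L₁ ∪ R₁ ∪ R₂)
    yz-cover   : ∀ v → v ∈ (L₁ ∪ R₁ ∪ R₂) → E v y ⊎ E v z

InH2 : ∀ {m} → (Fin m → Fin m → Set) → Set₁
InH2 E = H2-1 E ⊎ H2-2 E ⊎ H2-3 E

-- No vertex is full, so no singleton dominates, and {a},{b} form a coalition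
-- exactly when a ≠ b and N[a] ∪ N[b] = V. Thus Γ₁ is a coalition partition iff
-- every vertex has such a partner, and the coalition graph is read off from the
-- closed neighbourhoods. Since N[x] = {x,y,z}, two vertices outside N[x] never
-- form a coalition; in each family the remaining coalitions are checked region
-- by region of the vertex set, each vertex of W dominating all vertices but x, y, z.
module Submission where

open import Defs
open import Data.Nat using (ℕ)
open import Data.Fin using (Fin; _≟_)
open import Data.Fin.Properties using (all?)
open import Data.Product using (∃; _×_; _,_; proj₁; proj₂; map₁; map₂)
open import Data.Sum using (_⊎_; inj₁; inj₂; [_,_]; [_,_]′; swap)
open import Data.Empty using (⊥-elim)
open import Function.Base using (_∘_; id)
open import Function.Bundles using (Equivalence; _⇔_; mk⇔)
open import Relation.Nullary using (¬_; Dec; yes; no)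
open import Relation.Nullary.Decidable using (map; ¬?; _×-dec_; _⊎-dec_)
open import Relation.Unary using (_∈_; _∉_; _∪_; _∩_; ∁; _⊆_)
open import Relation.Binary.PropositionalEquality using (_≡_; _≢_; refl; ≢-sym)

module SingletonCoalitions {n : ℕ} (G : SimpleGraph n) where

  infix 4 _⋈_
  _⋈_ : Fin n → Fin n → Set
  _⋈_ = CG G (Γ₁ n)

  N[_] : Fin n → VSet n
  N[ a ] v = v ≡ a ⊎ Adj G a v

  N-self : ∀ {a} → a ∈ N[ a ]
  N-self = inj₁ refl

  N-sym : ∀ {a b} → a ∈ N[ b ] → b ∈ N[ a ]
  N-sym (inj₁ refl) = inj₁ refl
  N-sym (inj₂ e) = inj₂ (sym G e)

  adjAll⇒⊆N : ∀ {a S} → AdjAll (Adj G) a S → S ⊆ N[ a ]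
  adjAll⇒⊆N {a} adj {v} v∈S with v ≟ a
  ... | yes v≡a = inj₁ v≡a
  ... | no v≢a = inj₂ (adj v v∈S v≢a)

  ⋈-irrefl : ∀ {a b} → a ⋈ b → a ≢ b
  ⋈-irrefl (disjoint , _) a≡b = disjoint _ refl a≡b

  ⋈-sym : ∀ {a b} → a ⋈ b → b ⋈ a
  ⋈-sym (disjoint , ¬domA , ¬domB , dom) =
    (λ v p q → disjoint v q p) , ¬domB , ¬domA ,
    λ v v∉ → map₂ (map₁ swap) (dom v (v∉ ∘ swap))

  ⋈⇒dominates : ∀ {a b} → a ⋈ b → ∀ v → v ∈ N[ a ] ∪ N[ b ]
  ⋈⇒dominates {a} {b} (_ , _ , _ , dom) v with v ≟ a | v ≟ b
  ... | yes v≡a | _ = inj₁ (inj₁ v≡a)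
  ... | no _ | yes v≡b = inj₂ (inj₁ v≡b)
  ... | no v≢a | no v≢b with dom v [ v≢a , v≢b ]
  ...   | _ , inj₁ refl , e = inj₁ (inj₂ (sym G e))
  ...   | _ , inj₂ refl , e = inj₂ (inj₂ (sym G e))

  ¬⋈ : ∀ {a b v} → v ∉ N[ a ] → v ∉ N[ b ] → ¬ a ⋈ b
  ¬⋈ {v = v} v∉a v∉b c = [ v∉a , v∉b ] (⋈⇒dominates c v)

  module _ (noFull : NoFullVertex (Adj G)) where

    singleton-¬dominating : ∀ a → ¬ Dominating (Adj G) (_≡ a)
    singleton-¬dominating a dom with noFull a
    ... | u , u≢a , ¬au with dom u u≢a
    ...   | _ , refl , ua = ¬au (sym G ua)

    dominates⇒⋈ : ∀ {a b} → a ≢ b → (∀ v → v ∈ N[ a ] ∪ N[ b ]) → a ⋈ b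
    dominates⇒⋈ {a} {b} a≢b dom =
      (λ { _ refl refl → a≢b refl }) ,
      singleton-¬dominating a , singleton-¬dominating b , dominating
      where
      dominating : Dominating (Adj G) ((_≡ a) ∪ (_≡ b))
      dominating v v∉ with dom v
      ... | inj₁ (inj₁ v≡a) = ⊥-elim (v∉ (inj₁ v≡a))
      ... | inj₁ (inj₂ av) = a , inj₁ refl , sym G av
      ... | inj₂ (inj₁ v≡b) = ⊥-elim (v∉ (inj₂ v≡b))
      ... | inj₂ (inj₂ bv) = b , inj₂ refl , sym G bv

    _⋈?_ : ∀ a b → Dec (a ⋈ b)
    a ⋈? b = map (mk⇔ (λ (a≢b , dom) → dominates⇒⋈ a≢b dom)
                      (λ c → ⋈-irrefl c , ⋈⇒dominates c))
                 (¬? (a ≟ b) ×-dec all? λ v → N? a v ⊎-dec N? b v)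
      where
      N? : ∀ a v → Dec (v ∈ N[ a ])
      N? a v = (v ≟ a) ⊎-dec dec G a v

    singleton-partition : (∀ a → ∃ (a ⋈_)) → SingletonPartitionGraph G
    singleton-partition partner a = inj₂ (singleton-¬dominating a , partner a)

  module DegreeTwoVertex {x y z : Fin n}
           (Nx : ∀ v → Adj G x v ⇔ (v ≡ y ⊎ v ≡ z)) where

    y∈N[x] : y ∈ N[ x ]
    y∈N[x] = inj₂ (Equivalence.from (Nx y) (inj₁ refl))

    z∈N[x] : z ∈ N[ x ]
    z∈N[x] = inj₂ (Equivalence.from (Nx z) (inj₂ refl))

    ∉N[x] : ∀ {u} → u ≢ x × u ≢ y × u ≢ z → u ∉ N[ x ]
    ∉N[x] (u≢x , _ , _) (inj₁ u≡x) = u≢x u≡x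
    ∉N[x] {u} (_ , u≢y , u≢z) (inj₂ xu) = [ u≢y , u≢z ] (Equivalence.to (Nx u) xu)

    ¬⋈-outside-N[x] : ∀ {u v} → u ≢ x × u ≢ y × u ≢ z → v ≢ x × v ≢ y × v ≢ z →
                     ¬ u ⋈ v
    ¬⋈-outside-N[x] u∉ v∉ = ¬⋈ (∉N[x] u∉ ∘ N-sym) (∉N[x] v∉ ∘ N-sym)

module Family₁ {n : ℕ} {G : SimpleGraph n} (f : F2-1 G) where
  open F2-1 f
  open F2Base base
  open SingletonCoalitions G
  open DegreeTwoVertex Nx

  data Region (v : Fin n) : Set where
    at-x  : v ≡ x → Region v
    at-y  : v ≡ y → Region v
    at-z  : v ≡ z → Region v
    in-R₁ : v ∈ R₁ → Region v

  region : ∀ v → Region v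
  region v = [ at-x , [ at-y , [ at-z , in-R₁ ]′ ]′ ]′ (cover v)

  ⋈-by-regions : ∀ {a b} → a ≢ b → (∀ {v} → Region v → v ∈ N[ a ] ∪ N[ b ]) → a ⋈ b
  ⋈-by-regions a≢b dom = dominates⇒⋈ noFull a≢b (λ v → dom (region v))

  R₁⊆N[y] : R₁ ⊆ N[ y ]
  R₁⊆N[y] r = inj₂ (yR₁ _ r)

  R₁⊆N[z] : R₁ ⊆ N[ z ]
  R₁⊆N[z] r = inj₂ (zR₁ _ r)

  x⋈y : x ⋈ y
  x⋈y = ⋈-by-regions x≢y λ where
    (at-x refl) → inj₁ N-self
    (at-y refl) → inj₂ N-self
    (at-z refl) → inj₁ z∈N[x]
    (in-R₁ r)   → inj₂ (R₁⊆N[y] r)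

  x⋈z : x ⋈ z
  x⋈z = ⋈-by-regions x≢z λ where
    (at-x refl) → inj₁ N-self
    (at-y refl) → inj₁ y∈N[x]
    (at-z refl) → inj₂ N-self
    (in-R₁ r)   → inj₂ (R₁⊆N[z] r)

  y⋈z : y ⋈ z
  y⋈z = ⋈-by-regions y≢z λ where
    (at-x refl) → inj₁ (N-sym y∈N[x])
    (at-y refl) → inj₁ N-self
    (at-z refl) → inj₂ N-self
    (in-R₁ r)   → inj₁ (R₁⊆N[y] r)

  y⋈R₁ : ∀ r → r ∈ R₁ → y ⋈ r
  y⋈R₁ r r∈ = ⋈-by-regions (≢-sym (proj₁ (proj₂ (R₁-disj r r∈)))) λ where
    (at-x refl) → inj₁ (N-sym y∈N[x])
    (at-y refl) → inj₁ N-self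
    (at-z refl) → inj₂ (N-sym (R₁⊆N[z] r∈))
    (in-R₁ s)   → inj₁ (R₁⊆N[y] s)

  z⋈R₁ : ∀ r → r ∈ R₁ → z ⋈ r
  z⋈R₁ r r∈ = ⋈-by-regions (≢-sym (proj₂ (proj₂ (R₁-disj r r∈)))) λ where
    (at-x refl) → inj₁ (N-sym z∈N[x])
    (at-y refl) → inj₂ (N-sym (R₁⊆N[y] r∈))
    (at-z refl) → inj₁ N-self
    (in-R₁ s)   → inj₁ (R₁⊆N[z] s)

  partner : ∀ v → ∃ (v ⋈_)
  partner v with region v
  ... | at-x refl = y , x⋈y
  ... | at-y refl = z , y⋈z
  ... | at-z refl = x , ⋈-sym x⋈z
  ... | in-R₁ r   = y , ⋈-sym (y⋈R₁ v r)

  singleton-partition-graph : SingletonPartitionGraph G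
  singleton-partition-graph = singleton-partition noFull partner

  coalition-graph : H2-1 _⋈_
  coalition-graph = record
    { x = x ; y = y ; z = z ; x≢y = x≢y ; x≢z = x≢z ; y≢z = y≢z
    ; R₁ = R₁ ; R₁≠∅ = R₁≠∅ ; R₁-disj = R₁-disj ; cover = cover
    ; xy = x⋈y ; xz = x⋈z ; yz = y⋈z
    ; yR₁ = λ r r∈ _ → y⋈R₁ r r∈
    ; zR₁ = λ r r∈ _ → z⋈R₁ r r∈
    ; R₁-indep = λ u v u∈ v∈ → ¬⋈-outside-N[x] (R₁-disj u u∈) (R₁-disj v v∈) }

module Family₂ {n : ℕ} {G : SimpleGraph n} (f : F2-2 G) where
  open F2-2 f
  open F2Base base
  open SingletonCoalitions G
  open DegreeTwoVertex Nx

  data Region (v : Fin n) : Set where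
    at-x  : v ≡ x → Region v
    at-y  : v ≡ y → Region v
    at-z  : v ≡ z → Region v
    in-L₁ : v ∈ L₁ → Region v
    in-R₁ : v ∈ R₁ → Region v

  region : ∀ v → Region v
  region v = [ at-x , [ at-y , [ at-z , [ in-L₁ , in-R₁ ]′ ]′ ]′ ]′ (cover v)

  ⋈-by-regions : ∀ {a b} → a ≢ b → (∀ {v} → Region v → v ∈ N[ a ] ∪ N[ b ]) → a ⋈ b
  ⋈-by-regions a≢b dom = dominates⇒⋈ noFull a≢b (λ v → dom (region v))

  L₁R₁⊆N[y] : L₁ ∪ R₁ ⊆ N[ y ]
  L₁R₁⊆N[y] = adjAll⇒⊆N yL₁R₁

  x⋈y : x ⋈ y
  x⋈y = ⋈-by-regions x≢y λ where
    (at-x refl) → inj₁ N-self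
    (at-y refl) → inj₂ N-self
    (at-z refl) → inj₁ z∈N[x]
    (in-L₁ l)   → inj₂ (L₁R₁⊆N[y] (inj₁ l))
    (in-R₁ r)   → inj₂ (L₁R₁⊆N[y] (inj₂ r))

  y⋈z : y ⋈ z
  y⋈z = ⋈-by-regions y≢z λ where
    (at-x refl) → inj₁ (N-sym y∈N[x])
    (at-y refl) → inj₁ N-self
    (at-z refl) → inj₂ N-self
    (in-L₁ l)   → inj₁ (L₁R₁⊆N[y] (inj₁ l))
    (in-R₁ r)   → inj₁ (L₁R₁⊆N[y] (inj₂ r))

  y⋈R₁ : ∀ r → r ∈ R₁ → y ⋈ r
  y⋈R₁ r r∈ = ⋈-by-regions (≢-sym (proj₁ (proj₂ (R₁-disj r r∈)))) λ where
    (at-x refl) → inj₁ (N-sym y∈N[x])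
    (at-y refl) → inj₁ N-self
    (at-z refl) → inj₂ (N-sym (adjAll⇒⊆N zR₁ r∈))
    (in-L₁ l)   → inj₁ (L₁R₁⊆N[y] (inj₁ l))
    (in-R₁ s)   → inj₁ (L₁R₁⊆N[y] (inj₂ s))

  z⋈L₁ : ∀ l → l ∈ L₁ → z ⋈ l
  z⋈L₁ l l∈ = ⋈-by-regions (≢-sym (proj₂ (proj₂ (L₁-disj l l∈)))) λ where
    (at-x refl) → inj₁ (N-sym z∈N[x])
    (at-y refl) → inj₂ (N-sym (L₁R₁⊆N[y] (inj₁ l∈)))
    (at-z refl) → inj₁ N-self
    (in-L₁ k)   → inj₂ (adjAll⇒⊆N (L₁-compl l l∈) k)
    (in-R₁ r)   → inj₁ (adjAll⇒⊆N zR₁ r)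

  ¬x⋈z : ¬ x ⋈ z
  ¬x⋈z with L₁≠∅
  ... | l , l∈ = ¬⋈ (∉N[x] (L₁-disj l l∈))
                    [ proj₂ (proj₂ (L₁-disj l l∈)) , zL₁ l l∈ ]

  ¬y⋈L₁ : ∀ l → l ∈ L₁ → ¬ y ⋈ l
  ¬y⋈L₁ l l∈ = ¬⋈ {v = z} [ ≢-sym y≢z , ¬yz ]
                         [ ≢-sym (proj₂ (proj₂ (L₁-disj l l∈))) , zL₁ l l∈ ∘ sym G ]

  partners-of-L₁ : ∀ {l v} → l ∈ L₁ → l ⋈ v → v ≡ x ⊎ v ≡ z
  partners-of-L₁ {l} {v} l∈ c with region v
  ... | at-x v≡x = inj₁ v≡x
  ... | at-y refl = ⊥-elim (¬y⋈L₁ l l∈ (⋈-sym c))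
  ... | at-z v≡z = inj₂ v≡z
  ... | in-L₁ k = ⊥-elim (¬⋈-outside-N[x] (L₁-disj l l∈) (L₁-disj v k) c)
  ... | in-R₁ r = ⊥-elim (¬⋈-outside-N[x] (L₁-disj l l∈) (R₁-disj v r) c)

  L₁-partners : ∀ l → l ∈ L₁ →
                (∀ v → l ⋈ v ⇔ v ≡ z) ⊎ (∀ v → l ⋈ v ⇔ (v ≡ x ⊎ v ≡ z))
  L₁-partners l l∈ with _⋈?_ noFull l x
  ... | yes l⋈x = inj₂ λ v → mk⇔ (partners-of-L₁ l∈)
                    [ (λ { refl → l⋈x }) , (λ { refl → l⋈z }) ]′
    where
    l⋈z : l ⋈ z
    l⋈z = ⋈-sym (z⋈L₁ l l∈)
  ... | no ¬l⋈x = inj₁ λ v → mk⇔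
                    (λ c → [ (λ { refl → ⊥-elim (¬l⋈x c) }) , id ]′ (partners-of-L₁ l∈ c))
                    (λ { refl → ⋈-sym (z⋈L₁ l l∈) })

  partner : ∀ v → ∃ (v ⋈_)
  partner v with region v
  ... | at-x refl = y , x⋈y
  ... | at-y refl = z , y⋈z
  ... | at-z refl = y , ⋈-sym y⋈z
  ... | in-L₁ l   = z , ⋈-sym (z⋈L₁ v l)
  ... | in-R₁ r   = y , ⋈-sym (y⋈R₁ v r)

  singleton-partition-graph : SingletonPartitionGraph G
  singleton-partition-graph = singleton-partition noFull partner

  coalition-graph : H2-2 _⋈_
  coalition-graph = record
    { x = x ; y = y ; z = z ; x≢y = x≢y ; x≢z = x≢z ; y≢z = y≢z
    ; L₁ = L₁ ; R₁ = R₁ ; L₁≠∅ = L₁≠∅ ; R₁≠∅ = R₁≠∅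
    ; L₁-disj = L₁-disj ; R₁-disj = R₁-disj ; L₁R₁-disj = L₁R₁-disj
    ; cover = cover
    ; yR₁ = λ r r∈ _ → y⋈R₁ r r∈
    ; yx = ⋈-sym x⋈y ; yz = y⋈z
    ; zL₁ = λ l l∈ _ → z⋈L₁ l l∈
    ; ¬xz = ¬x⋈z ; yL₁ = ¬y⋈L₁
    ; indep = λ u v u∈ v∈ → ¬⋈-outside-N[x] ([ L₁-disj u , R₁-disj u ]′ u∈)
                                            ([ L₁-disj v , R₁-disj v ]′ v∈)
    ; L₁-deg = L₁-partners }

module Family₃ {n : ℕ} {G : SimpleGraph n} (f : F2-3 G) where
  open F2-3 f
  open F2Base base
  open SingletonCoalitions G
  open DegreeTwoVertex Nx

  data Region (v : Fin n) : Set where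
    at-x  : v ≡ x → Region v
    at-y  : v ≡ y → Region v
    at-z  : v ≡ z → Region v
    in-L₁ : v ∈ L₁ → Region v
    in-R₁ : v ∈ R₁ → Region v
    in-R₂ : v ∈ R₂ → Region v
    in-W  : v ∈ W → Region v

  region : ∀ v → Region v
  region v = [ at-x , [ at-y , [ at-z , [ in-L₁ , [ in-R₁ , [ in-R₂ ,
               in-W ∘ [ L₂⊆W , id ]′ ]′ ]′ ]′ ]′ ]′ ]′ (cover v)

  ⋈-by-regions : ∀ {a b} → a ≢ b → (∀ {v} → Region v → v ∈ N[ a ] ∪ N[ b ]) → a ⋈ b
  ⋈-by-regions a≢b dom = dominates⇒⋈ noFull a≢b (λ v → dom (region v))

  Middle : VSet n
  Middle = L₁ ∪ R₁ ∪ R₂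

  Middle-disj : NotXYZ x y z Middle
  Middle-disj m = [ L₁-disj m , [ R₁-disj m , R₂-disj m ]′ ]′

  L₁R₁⊆N[y] : L₁ ∪ R₁ ⊆ N[ y ]
  L₁R₁⊆N[y] = adjAll⇒⊆N yL₁R₁

  R₁R₂⊆N[z] : R₁ ∪ R₂ ⊆ N[ z ]
  R₁R₂⊆N[z] = adjAll⇒⊆N zR₁R₂

  Middle⊆N[W] : ∀ {w} → w ∈ W → Middle ⊆ N[ w ]
  Middle⊆N[W] w∈ = adjAll⇒⊆N (W-adj _ w∈)

  W⊆N[W] : ∀ {w} → w ∈ W → W ⊆ N[ w ]
  W⊆N[W] w∈ = adjAll⇒⊆N (W-compl _ w∈)

  l₀ r₀ w₀ : Fin n
  l₀ = proj₁ L₁≠∅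
  r₀ = proj₁ R₂≠∅
  w₀ = proj₁ W≠∅

  l₀∈ : l₀ ∈ L₁
  l₀∈ = proj₂ L₁≠∅

  r₀∈ : r₀ ∈ R₂
  r₀∈ = proj₂ R₂≠∅

  w₀∈ : w₀ ∈ W
  w₀∈ = proj₂ W≠∅

  l₀∉N[z] : l₀ ∉ N[ z ]
  l₀∉N[z] = [ proj₂ (proj₂ (L₁-disj l₀ l₀∈)) , zL₁ l₀ l₀∈ ]

  r₀∉N[y] : r₀ ∉ N[ y ]
  r₀∉N[y] = [ proj₁ (proj₂ (R₂-disj r₀ r₀∈)) , yR₂ r₀ r₀∈ ]

  W-disj : NotXYZ x y z W
  W-disj w w∈ =
    (λ { refl → ∉N[x] (L₁-disj l₀ l₀∈) (Middle⊆N[W] w∈ (inj₁ l₀∈)) }) ,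
    (λ { refl → r₀∉N[y] (Middle⊆N[W] w∈ (inj₂ (inj₂ r₀∈))) }) ,
    (λ { refl → l₀∉N[z] (Middle⊆N[W] w∈ (inj₁ l₀∈)) })

  ⋈W : ∀ {a w} → w ∈ W → a ≢ w → x ∈ N[ a ] → y ∈ N[ a ] → z ∈ N[ a ] → a ⋈ w
  ⋈W w∈ a≢w x∈ y∈ z∈ = ⋈-by-regions a≢w λ where
    (at-x refl) → inj₁ x∈
    (at-y refl) → inj₁ y∈
    (at-z refl) → inj₁ z∈
    (in-L₁ l)   → inj₂ (Middle⊆N[W] w∈ (inj₁ l))
    (in-R₁ r)   → inj₂ (Middle⊆N[W] w∈ (inj₂ (inj₁ r)))
    (in-R₂ r)   → inj₂ (Middle⊆N[W] w∈ (inj₂ (inj₂ r)))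
    (in-W u)    → inj₂ (W⊆N[W] w∈ u)

  x⋈W : ∀ w → w ∈ W → x ⋈ w
  x⋈W w w∈ = ⋈W w∈ (≢-sym (proj₁ (W-disj w w∈))) N-self y∈N[x] z∈N[x]

  y⋈W : Adj G y z → ∀ {w} → w ∈ W → y ⋈ w
  y⋈W yz w∈ = ⋈W w∈ (≢-sym (proj₁ (proj₂ (W-disj _ w∈)))) (N-sym y∈N[x]) N-self (inj₂ yz)

  z⋈W : Adj G y z → ∀ {w} → w ∈ W → z ⋈ w
  z⋈W yz w∈ = ⋈W w∈ (≢-sym (proj₂ (proj₂ (W-disj _ w∈)))) (N-sym z∈N[x]) (inj₂ (sym G yz))
                 N-self

  Middle⋈z : ∀ {m} → m ∈ Middle → AdjAll (Adj G) m L₁ → y ∈ N[ m ] ∪ N[ z ] → m ⋈ z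
  Middle⋈z m∈ adjL₁ y∈ = ⋈-by-regions (proj₂ (proj₂ (Middle-disj _ m∈))) λ where
    (at-x refl) → inj₂ (N-sym z∈N[x])
    (at-y refl) → y∈
    (at-z refl) → inj₂ N-self
    (in-L₁ l)   → inj₁ (adjAll⇒⊆N adjL₁ l)
    (in-R₁ r)   → inj₂ (R₁R₂⊆N[z] (inj₁ r))
    (in-R₂ r)   → inj₂ (R₁R₂⊆N[z] (inj₂ r))
    (in-W w)    → inj₁ (N-sym (Middle⊆N[W] w m∈))

  Middle⋈y : ∀ {m} → m ∈ Middle → AdjAll (Adj G) m R₂ → z ∈ N[ m ] ∪ N[ y ] → m ⋈ y
  Middle⋈y m∈ adjR₂ z∈ = ⋈-by-regions (proj₁ (proj₂ (Middle-disj _ m∈))) λ where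
    (at-x refl) → inj₂ (N-sym y∈N[x])
    (at-y refl) → inj₂ N-self
    (at-z refl) → z∈
    (in-L₁ l)   → inj₂ (L₁R₁⊆N[y] (inj₁ l))
    (in-R₁ r)   → inj₂ (L₁R₁⊆N[y] (inj₂ r))
    (in-R₂ r)   → inj₁ (adjAll⇒⊆N adjR₂ r)
    (in-W w)    → inj₁ (N-sym (Middle⊆N[W] w m∈))

  L₁-shape : ∀ {l} → l ∈ L₁ → AdjAll (Adj G) l L₁ ⊎ (Adj G y z × AdjAll (Adj G) l R₂)
  L₁-shape l∈ with yz-cond
  ... | inj₁ (_ , L₁-compl , _) = inj₁ (L₁-compl _ l∈)
  ... | inj₂ (yz , L₁-cond , _) = [ inj₁ , (λ adjR₂ → inj₂ (yz , adjR₂)) ]′ (L₁-cond _ l∈)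

  R₂-shape : ∀ {r} → r ∈ R₂ → AdjAll (Adj G) r R₂ ⊎ (Adj G y z × AdjAll (Adj G) r L₁)
  R₂-shape r∈ with yz-cond
  ... | inj₁ (_ , _ , R₂-compl) = inj₁ (R₂-compl _ r∈)
  ... | inj₂ (yz , _ , R₂-cond) = [ (λ adjL₁ → inj₂ (yz , adjL₁)) , inj₁ ]′ (R₂-cond _ r∈)

  Middle-partner : ∀ {m} → m ∈ Middle → m ⋈ y ⊎ m ⋈ z
  Middle-partner m∈@(inj₁ l) with L₁-shape l
  ... | inj₁ adjL₁ = inj₂ (Middle⋈z m∈ adjL₁ (inj₁ (N-sym (L₁R₁⊆N[y] (inj₁ l)))))
  ... | inj₂ (yz , adjR₂) = inj₁ (Middle⋈y m∈ adjR₂ (inj₂ (inj₂ yz)))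
  Middle-partner m∈@(inj₂ (inj₁ r)) with R₁-cond _ r
  ... | inj₁ adjL₁ = inj₂ (Middle⋈z m∈ adjL₁ (inj₁ (N-sym (L₁R₁⊆N[y] (inj₂ r)))))
  ... | inj₂ adjR₂ = inj₁ (Middle⋈y m∈ adjR₂ (inj₁ (N-sym (R₁R₂⊆N[z] (inj₁ r)))))
  Middle-partner m∈@(inj₂ (inj₂ r)) with R₂-shape r
  ... | inj₁ adjR₂ = inj₁ (Middle⋈y m∈ adjR₂ (inj₁ (N-sym (R₁R₂⊆N[z] (inj₂ r)))))
  ... | inj₂ (yz , adjL₁) = inj₂ (Middle⋈z m∈ adjL₁ (inj₂ (inj₂ (sym G yz))))

  y-partner : ∃ (y ⋈_)
  y-partner with R₂-shape r₀∈
  ... | inj₁ adjR₂ =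
    r₀ , ⋈-sym (Middle⋈y (inj₂ (inj₂ r₀∈)) adjR₂ (inj₁ (N-sym (R₁R₂⊆N[z] (inj₂ r₀∈)))))
  ... | inj₂ (yz , _) = w₀ , y⋈W yz w₀∈

  z-partner : ∃ (z ⋈_)
  z-partner with L₁-shape l₀∈
  ... | inj₁ adjL₁ =
    l₀ , ⋈-sym (Middle⋈z (inj₁ l₀∈) adjL₁ (inj₁ (N-sym (L₁R₁⊆N[y] (inj₁ l₀∈)))))
  ... | inj₂ (yz , _) = w₀ , z⋈W yz w₀∈

  partner : ∀ v → ∃ (v ⋈_)
  partner v with region v
  ... | at-x refl = w₀ , x⋈W w₀ w₀∈
  ... | at-y refl = y-partner
  ... | at-z refl = z-partner
  ... | in-L₁ l   = [ (y ,_) , (z ,_) ]′ (Middle-partner (inj₁ l))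
  ... | in-R₁ r   = [ (y ,_) , (z ,_) ]′ (Middle-partner (inj₂ (inj₁ r)))
  ... | in-R₂ r   = [ (y ,_) , (z ,_) ]′ (Middle-partner (inj₂ (inj₂ r)))
  ... | in-W w    = x , ⋈-sym (x⋈W v w)

  singleton-partition-graph : SingletonPartitionGraph G
  singleton-partition-graph = singleton-partition noFull partner

  ¬x⋈y : ¬ x ⋈ y
  ¬x⋈y = ¬⋈ (∉N[x] (R₂-disj r₀ r₀∈)) r₀∉N[y]

  ¬x⋈z : ¬ x ⋈ z
  ¬x⋈z = ¬⋈ (∉N[x] (L₁-disj l₀ l₀∈)) l₀∉N[z]

  -- W′ is the neighbourhood of x in the coalition graph; it contains W but, when
  -- extra edges were added, possibly middle vertices too, so those are split off.
  L₁′ R₁′ R₂′ W′ : VSet n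
  L₁′ = L₁ ∩ ∁ (x ⋈_)
  R₁′ = R₁ ∩ ∁ (x ⋈_)
  R₂′ = R₂ ∩ ∁ (x ⋈_)
  W′  = x ⋈_

  Middle′⊆Middle : L₁′ ∪ R₁′ ∪ R₂′ ⊆ Middle
  Middle′⊆Middle = [ inj₁ ∘ proj₁ , [ inj₂ ∘ inj₁ ∘ proj₁ , inj₂ ∘ inj₂ ∘ proj₁ ]′ ]′

  W′-disj : NotXYZ x y z W′
  W′-disj v x⋈v = ≢-sym (⋈-irrefl x⋈v) , (λ { refl → ¬x⋈y x⋈v }) , (λ { refl → ¬x⋈z x⋈v })

  cover′ : ∀ v → v ≡ x ⊎ v ≡ y ⊎ v ≡ z ⊎ v ∈ L₁′ ∪ R₁′ ∪ R₂′ ∪ W′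
  cover′ v with _⋈?_ noFull x v | region v
  ... | yes x⋈v | _        = inj₂ (inj₂ (inj₂ (inj₂ (inj₂ (inj₂ x⋈v)))))
  ... | no _    | at-x p   = inj₁ p
  ... | no _    | at-y p   = inj₂ (inj₁ p)
  ... | no _    | at-z p   = inj₂ (inj₂ (inj₁ p))
  ... | no ¬x⋈v | in-L₁ p = inj₂ (inj₂ (inj₂ (inj₁ (p , ¬x⋈v))))
  ... | no ¬x⋈v | in-R₁ p = inj₂ (inj₂ (inj₂ (inj₂ (inj₁ (p , ¬x⋈v)))))
  ... | no ¬x⋈v | in-R₂ p = inj₂ (inj₂ (inj₂ (inj₂ (inj₂ (inj₁ (p , ¬x⋈v))))))
  ... | no ¬x⋈v | in-W p  = ⊥-elim (¬x⋈v (x⋈W v p))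

  coalition-graph : H2-3 _⋈_
  coalition-graph = record
    { x = x ; y = y ; z = z ; x≢y = x≢y ; x≢z = x≢z ; y≢z = y≢z
    ; L₁ = L₁′ ; R₁ = R₁′ ; R₂ = R₂′ ; W = W′
    ; W≠∅ = w₀ , x⋈W w₀ w₀∈
    ; L₁-disj = λ v → L₁-disj v ∘ proj₁
    ; R₁-disj = λ v → R₁-disj v ∘ proj₁
    ; R₂-disj = λ v → R₂-disj v ∘ proj₁
    ; W-disj = W′-disj
    ; L₁R₁-disj = λ v p q → L₁R₁-disj v (proj₁ p) (proj₁ q)
    ; L₁R₂-disj = λ v p q → L₁R₂-disj v (proj₁ p) (proj₁ q)
    ; L₁W-disj = λ v p → proj₂ p
    ; R₁R₂-disj = λ v p q → R₁R₂-disj v (proj₁ p) (proj₁ q)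
    ; R₁W-disj = λ v p → proj₂ p
    ; R₂W-disj = λ v p → proj₂ p
    ; cover = cover′
    ; indep = λ u v u∈ v∈ → ¬⋈-outside-N[x] (disj u u∈) (disj v v∈)
    ; ¬xy = ¬x⋈y ; ¬xz = ¬x⋈z
    ; xW = λ _ x⋈w _ → x⋈w
    ; xNone = λ _ → [ proj₂ , [ proj₂ , proj₂ ]′ ]′
    ; yz-cover = λ _ → Middle-partner ∘ Middle′⊆Middle }
    where
    disj : NotXYZ x y z (L₁′ ∪ R₁′ ∪ R₂′ ∪ W′)
    disj v (inj₁ (l , _))               = L₁-disj v l
    disj v (inj₂ (inj₁ (r , _)))        = R₁-disj v r
    disj v (inj₂ (inj₂ (inj₁ (r , _)))) = R₂-disj v r
    disj v (inj₂ (inj₂ (inj₂ x⋈v)))     = W′-disj v x⋈v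

theorem7 : ∀ {n : ℕ} (G : SimpleGraph n) → InF2 G →
             SingletonPartitionGraph G × InH2 (CG G (Γ₁ n))
theorem7 G (inj₁ f) =
  Family₁.singleton-partition-graph f , inj₁ (Family₁.coalition-graph f)
theorem7 G (inj₂ (inj₁ f)) =
  Family₂.singleton-partition-graph f , inj₂ (inj₁ (Family₂.coalition-graph f))
theorem7 G (inj₂ (inj₂ f)) =
  Family₃.singleton-partition-graph f , inj₂ (inj₂ (Family₃.coalition-graph f))
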